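{- Let $p$ be a prime and let $\mathbb{P}=PG(2,p)$ be the projective plane of order $p$. Consider the switching game on $\mathbb{P}$. Then every configuration of the board $\mathbb{P}$ with at least $2$ lit bulbs is reducible.
   Context: The switching game on a finite incidence structure (here a projective plane) is defined as follows. There is one light bulb at each point, and each bulb is either on (lit) or off. There is one switch for each line; flipping the switch of a line toggles the state (on $\leftrightarrow$ off) of every bulb at a point of that line. A configuration is an assignment of on/off states to all bulbs. A configuration is reducible if some finite sequence of switch flips produces a configuration with strictly fewer lit bulbs than the initial one. -}

module Defs where

open import Data.Nat using (ℕ; zero; suc; _+_; _*_; _<_; _≟_; NonZero)
open import Data.Nat.DivMod using (_%_)
open import Data.Fin using (Fin; toℕ)
open import Data.Fin.Properties using (all?)
open import Data.Bool using (Bool; true; false; not; if_then_else_)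
open import Data.List using (List; []; _∷_; foldr)
open import Data.Product using (Σ; _×_; _,_; proj₁; proj₂; ∃)
open import Data.Product.Properties using ()
open import Data.Sum using (_⊎_; inj₁; inj₂)
open import Relation.Binary.PropositionalEquality using (_≡_)
open import Relation.Nullary using (Dec; yes; no)
open import Relation.Nullary.Decidable using (_×-dec_; _⊎-dec_)

-- Homogeneous coordinates over ℤ/pℤ, with entries represented by Fin p.
Triple : ℕ → Set
Triple p = Fin p × Fin p × Fin p

-- A nonzero triple normalized so that its first nonzero coordinate is 1.
-- Normalized triples are canonical representatives of the 1-dimensional
-- subspaces of (ℤ/pℤ)^3, i.e. of the points (and, dually, lines) of PG(2,p).
Normalized : ∀ {p} → Triple p → Set
Normalized (x , y , z) =
  (toℕ x ≡ 1) ⊎ ((toℕ x ≡ 0) × (toℕ y ≡ 1)) ⊎ ((toℕ x ≡ 0) × (toℕ y ≡ 0) × (toℕ z ≡ 1))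

normalized? : ∀ {p} (t : Triple p) → Dec (Normalized t)
normalized? (x , y , z) =
  (toℕ x ≟ 1) ⊎-dec (((toℕ x ≟ 0) ×-dec (toℕ y ≟ 1)) ⊎-dec ((toℕ x ≟ 0) ×-dec ((toℕ y ≟ 0) ×-dec (toℕ z ≟ 1))))

Point : ℕ → Set
Point p = Σ (Triple p) Normalized

-- Lines of PG(2,p) (given by their dual homogeneous coordinates)
Line : ℕ → Set
Line p = Σ (Triple p) Normalized

dot : ∀ {p} → Triple p → Triple p → ℕ
dot (a , b , c) (x , y , z) = toℕ a * toℕ x + toℕ b * toℕ y + toℕ c * toℕ z

Incident? : ∀ {p} → Line p → Point p → Bool
Incident? {zero} L P = false   -- vacuous: there are no triples when p = 0
Incident? {suc p} L P with dot (proj₁ L) (proj₁ P) % suc p ≟ 0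
... | yes _ = true
... | no _ = false

-- A configuration: on (true) / off (false) state of the bulb at each point.
Config : ℕ → Set
Config p = Point p → Bool

flip : ∀ {p} → Line p → Config p → Config p
flip L c P = if Incident? L P then not (c P) else c P

flips : ∀ {p} → List (Line p) → Config p → Config p
flips ls c = foldr flip c ls

sumFin : ∀ n → (Fin n → ℕ) → ℕ
sumFin zero f = 0
sumFin (suc n) f = f Fin.zero + sumFin n (λ i → f (Fin.suc i))

lit : ∀ {p} → Config p → ℕ
lit {p} c = sumFin p λ x → sumFin p λ y → sumFin p λ z → count (x , y , z)
  where
  count : Triple p → ℕ
  count t with normalized? t
  ... | yes n = if c (t , n) then 1 else 0
  ... | no _ = 0

Reducible : ∀ {p} → Config p → Set
Reducible {p} c = ∃ λ (ls : List (Line p)) → lit (flips ls c) < lit c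

-- For odd p, the p + 1 lines through a point C meet C an even number of times
-- and every other point exactly once, so flipping all of them toggles every
-- bulb except the one at C.  Flipping the pencils of two lit points P and Q
-- thus toggles exactly P and Q and switches off two bulbs.  Writing the pencil
-- as the zero set of a linear form α together with the zero sets of κ + t·α,
-- t ∈ 𝔽ₚ, the count reduces to the affine congruence κ + t·α ≡ 0, which has
-- exactly one root t when α ≢ 0 because p is prime.  For p = 2 flip instead the
-- line through P and Q: this switches off P and Q and changes only the third
-- point of that line.

module Submission where

open import Defs
open import Data.Nat using (ℕ; _≤_)
open import Data.Nat.Primality using (Prime)

open import Data.Nat using (zero; suc; parity; _+_; _*_; _<_; _%_; _/_; _∸_; _≟_; NonZero; nonTrivial⇒n>1; s≤s; z≤n; s≤s⁻¹)
open import Data.Nat.DivMod using (m≡m%n+[m/n]*n; m%n<n; m<n⇒m%n≡m; %-remove-+ʳ; [m+kn]%n≡m%n)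
open import Data.Nat.Divisibility using (_∣_; _∣0; ∣-refl; ∣m∣n⇒∣m+n; ∣m+n∣m⇒∣n; n∣m*n; ∣n⇒∣m*n; ∣⇒≤; n∣m⇒m%n≡0; m%n≡0⇒n∣m)
open import Data.Nat.Primality using (euclidsLemma; prime⇒irreducible; prime⇒nonTrivial)
open import Data.Nat.Solver using (module +-*-Solver)
import Data.Nat.Properties as ℕ
open import Data.Nat.Properties using (module ≤-Reasoning; +-assoc; +-cancelˡ-≡; ≤-refl; ≤-trans; +-mono-≤; +-mono-<-≤; +-mono-≤-<; +-suc; ≡-irrelevant)
open import Data.Fin using (Fin; toℕ; fromℕ<; punchOut) renaming (zero to fzero; suc to fsuc)
import Data.Fin.Properties as Fin
open import Data.Bool using (Bool; true; false; not; _∧_; _xor_; if_then_else_)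
open import Data.Bool.Properties using (∧-zeroʳ; ∧-identityʳ; xor-identityʳ; xor-assoc; not-distribʳ-xor; not-involutive)
open import Data.List using (List; []; _∷_; _++_; foldr; tabulate)
open import Data.Parity using (0ℙ; 1ℙ)
open import Data.Product using (Σ; ∃; _×_; _,_; proj₁; proj₂)
open import Data.Product.Properties using (≡-dec)
open import Data.Sum using (_⊎_; inj₁; inj₂)
open import Data.Unit using (tt)
open import Function using (_∘_)
open import Function.Definitions using (Injective)
open import Relation.Binary.Definitions using (DecidableEquality; tri<; tri≈; tri>)
open import Relation.Binary.PropositionalEquality
open import Relation.Nullary using (Dec; yes; no; ¬_; contradiction)
open import Relation.Nullary.Decidable using (⌊_⌋; map′; toWitness; ¬?; _×-dec_; _⊎-dec_; _→-dec_)
open import Relation.Nullary.Irrelevant using (Irrelevant)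

private
  variable
    p n : ℕ

_≟ₜ_ : DecidableEquality (Triple p)
_≟ₜ_ = ≡-dec Fin._≟_ (≡-dec Fin._≟_ Fin._≟_)

private
  1≢0 : {A : Set} {m : ℕ} → m ≡ 1 → m ≡ 0 → A
  1≢0 refl ()

normalized-irrelevant : {t : Triple p} → Irrelevant (Normalized t)
normalized-irrelevant (inj₁ a) (inj₁ a′) = cong inj₁ (≡-irrelevant a a′)
normalized-irrelevant (inj₂ (inj₁ (a , b))) (inj₂ (inj₁ (a′ , b′))) =
  cong (inj₂ ∘ inj₁) (cong₂ _,_ (≡-irrelevant a a′) (≡-irrelevant b b′))
normalized-irrelevant (inj₂ (inj₂ (a , b , c))) (inj₂ (inj₂ (a′ , b′ , c′))) =
  cong (inj₂ ∘ inj₂) (cong₂ _,_ (≡-irrelevant a a′) (cong₂ _,_ (≡-irrelevant b b′) (≡-irrelevant c c′)))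
normalized-irrelevant (inj₁ a) (inj₂ (inj₁ (a′ , _))) = 1≢0 a a′
normalized-irrelevant (inj₁ a) (inj₂ (inj₂ (a′ , _))) = 1≢0 a a′
normalized-irrelevant (inj₂ (inj₁ (a , _))) (inj₁ a′) = 1≢0 a′ a
normalized-irrelevant (inj₂ (inj₂ (a , _))) (inj₁ a′) = 1≢0 a′ a
normalized-irrelevant (inj₂ (inj₁ (_ , b))) (inj₂ (inj₂ (_ , b′ , _))) = 1≢0 b b′
normalized-irrelevant (inj₂ (inj₂ (_ , b , _))) (inj₂ (inj₁ (_ , b′))) = 1≢0 b′ b

point-≡ : {P Q : Point p} → proj₁ P ≡ proj₁ Q → P ≡ Q
point-≡ {P = t , n} {Q = .t , n′} refl = cong (t ,_) (normalized-irrelevant n n′)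

_≟ₚ_ : DecidableEquality (Point p)
P ≟ₚ Q with proj₁ P ≟ₜ proj₁ Q
... | yes e = yes (point-≡ e)
... | no ne = no (ne ∘ cong proj₁)

-- Counting lit bulbs

sumFin-mono : {f g : Fin n → ℕ} → (∀ i → f i ≤ g i) → sumFin n f ≤ sumFin n g
sumFin-mono {zero}  f≤g = z≤n
sumFin-mono {suc n} f≤g = +-mono-≤ (f≤g fzero) (sumFin-mono (f≤g ∘ fsuc))

sumFin-mono-< : {f g : Fin n → ℕ} → (∀ i → f i ≤ g i) → (i₀ : Fin n) → f i₀ < g i₀ →
                sumFin n f < sumFin n g
sumFin-mono-< f≤g fzero     f<g = +-mono-<-≤ f<g (sumFin-mono (f≤g ∘ fsuc))
sumFin-mono-< f≤g (fsuc i₀) f<g = +-mono-≤-< (f≤g fzero) (sumFin-mono-< (f≤g ∘ fsuc) i₀ f<g)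

sumFin-≤-suc : {f g : Fin n → ℕ} (i₀ : Fin n) → (∀ i → i ≢ i₀ → f i ≤ g i) → f i₀ ≤ suc (g i₀) →
               sumFin n f ≤ suc (sumFin n g)
sumFin-≤-suc fzero     f≤g f≤1+g = +-mono-≤ f≤1+g (sumFin-mono λ i → f≤g (fsuc i) λ ())
sumFin-≤-suc {f = f} {g} (fsuc i₀) f≤g f≤1+g = begin
  f fzero + sumFin _ (f ∘ fsuc)        ≤⟨ +-mono-≤ (f≤g fzero λ ()) rest ⟩
  g fzero + suc (sumFin _ (g ∘ fsuc))  ≡⟨ +-suc (g fzero) _ ⟩
  suc (g fzero + sumFin _ (g ∘ fsuc))  ∎
  where
  open ≤-Reasoning
  rest : sumFin _ (f ∘ fsuc) ≤ suc (sumFin _ (g ∘ fsuc))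
  rest = sumFin-≤-suc i₀ (λ i i≢i₀ → f≤g (fsuc i) (i≢i₀ ∘ Fin.suc-injective)) f≤1+g

sumFin-pos : {f : Fin n → ℕ} → 0 < sumFin n f → ∃ λ i → 0 < f i
sumFin-pos {suc n} {f} pos with f fzero in eq
... | suc _ = fzero , subst (0 <_) (sym eq) (s≤s z≤n)
... | zero  = let (i , fi>0) = sumFin-pos {n} pos in fsuc i , fi>0

sumFin-cong : {f g : Fin n → ℕ} → (∀ i → f i ≡ g i) → sumFin n f ≡ sumFin n g
sumFin-cong {zero}  f≗g = refl
sumFin-cong {suc n} f≗g = cong₂ _+_ (f≗g fzero) (sumFin-cong (f≗g ∘ fsuc))

sum³ : (Triple p → ℕ) → ℕ
sum³ {p} f = sumFin p λ x → sumFin p λ y → sumFin p λ z → f (x , y , z)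

module _ {f g : Triple p → ℕ} where

  sum³-mono-< : (∀ t → f t ≤ g t) → (t₀ : Triple p) → f t₀ < g t₀ → sum³ f < sum³ g
  sum³-mono-< f≤g (x₀ , y₀ , z₀) f<g =
    sumFin-mono-< (λ x → sumFin-mono λ y → sumFin-mono λ z → f≤g (x , y , z)) x₀
      (sumFin-mono-< (λ y → sumFin-mono λ z → f≤g (x₀ , y , z)) y₀
        (sumFin-mono-< (λ z → f≤g (x₀ , y₀ , z)) z₀ f<g))

  sum³-≤-suc : (t₀ : Triple p) → (∀ t → t ≢ t₀ → f t ≤ g t) → f t₀ ≤ suc (g t₀) → sum³ f ≤ suc (sum³ g)
  sum³-≤-suc (x₀ , y₀ , z₀) f≤g f≤1+g =
    sumFin-≤-suc x₀ (λ x x≢ → sumFin-mono λ y → sumFin-mono λ z → f≤g (x , y , z) (x≢ ∘ cong proj₁))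
      (sumFin-≤-suc y₀ (λ y y≢ → sumFin-mono λ z → f≤g (x₀ , y , z) (y≢ ∘ cong (proj₁ ∘ proj₂)))
        (sumFin-≤-suc z₀ (λ z z≢ → f≤g (x₀ , y₀ , z) (z≢ ∘ cong (proj₂ ∘ proj₂))) f≤1+g))

sum³-pos : {f : Triple p → ℕ} → 0 < sum³ f → ∃ λ t → 0 < f t
sum³-pos pos =
  let (x , pos₁) = sumFin-pos pos ; (y , pos₂) = sumFin-pos pos₁ ; (z , pos₃) = sumFin-pos pos₂
  in (x , y , z) , pos₃

indicator : Bool → ℕ
indicator b = if b then 1 else 0

bulb : Config p → Triple p → ℕ
bulb c t with normalized? t
... | yes n = indicator (c (t , n))
... | no _  = 0

-- `_` is the local counting function of `lit`, which cannot be named; it agrees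
-- with `bulb` once the coordinates are split far enough for `normalized?` to compute.
lit≡sum³ : (c : Config p) → lit c ≡ sum³ (bulb c)
lit≡sum³ c = sumFin-cong λ x → sumFin-cong λ y → sumFin-cong λ z → pointwise x y z
  where
  pointwise : ∀ x y z → _ ≡ bulb c (x , y , z)
  pointwise fzero           fzero           fzero           = refl
  pointwise fzero           fzero           (fsuc fzero)    = refl
  pointwise fzero           fzero           (fsuc (fsuc _)) = refl
  pointwise fzero           (fsuc fzero)    _               = refl
  pointwise fzero           (fsuc (fsuc _)) _               = refl
  pointwise (fsuc fzero)    _               _               = refl
  pointwise (fsuc (fsuc _)) _               _               = refl

_⊆_ : Config p → Config p → Set
c′ ⊆ c = ∀ R → c′ R ≡ true → c R ≡ true

_⊆_outside_ : Config p → Config p → Triple p → Set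
c′ ⊆ c outside X = ∀ R → proj₁ R ≢ X → c′ R ≡ true → c R ≡ true

indicator-mono : {a b : Bool} → (a ≡ true → b ≡ true) → indicator a ≤ indicator b
indicator-mono {false} a⇒b = z≤n
indicator-mono {true}  a⇒b rewrite a⇒b refl = ≤-refl

indicator-≤1 : (b : Bool) → indicator b ≤ 1
indicator-≤1 false = z≤n
indicator-≤1 true  = ≤-refl

bulb≡indicator : (c : Config p) (P : Point p) → bulb c (proj₁ P) ≡ indicator (c P)
bulb≡indicator c (t , n) with normalized? t
... | yes n′ = cong (indicator ∘ c ∘ (t ,_)) (normalized-irrelevant n′ n)
... | no ¬n  = contradiction n ¬n

bulb-≤1 : (c : Config p) (t : Triple p) → bulb c t ≤ 1
bulb-≤1 c t with normalized? t
... | yes n = indicator-≤1 (c (t , n))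
... | no _  = z≤n

bulb-mono-outside : {c′ c : Config p} (X : Triple p) → c′ ⊆ c outside X →
                    ∀ t → t ≢ X → bulb c′ t ≤ bulb c t
bulb-mono-outside X c′⊆c t t≢X with normalized? t
... | yes n = indicator-mono (c′⊆c (t , n) t≢X)
... | no _  = z≤n

bulb-mono : {c′ c : Config p} → c′ ⊆ c → ∀ t → bulb c′ t ≤ bulb c t
bulb-mono c′⊆c t with normalized? t
... | yes n = indicator-mono (c′⊆c (t , n))
... | no _  = z≤n

bulb-pos : (c : Config p) (t : Triple p) → 0 < bulb c t → ∃ λ n → c (t , n) ≡ true
bulb-pos c t pos with normalized? t
... | no _ = contradiction pos λ ()
... | yes n with c (t , n) in eq
...   | true  = n , eq
...   | false = contradiction pos λ ()

lit-≤-suc : {c′ c : Config p} (X : Triple p) → c′ ⊆ c outside X → lit c′ ≤ suc (lit c)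
lit-≤-suc {c′ = c′} {c} X c′⊆c
  rewrite lit≡sum³ c′ | lit≡sum³ c =
  sum³-≤-suc X (bulb-mono-outside X c′⊆c) (≤-trans (bulb-≤1 c′ X) (s≤s z≤n))

lit-mono-< : {c′ c : Config p} → c′ ⊆ c → (P : Point p) → c′ P ≡ false → c P ≡ true → lit c′ < lit c
lit-mono-< {c′ = c′} {c} c′⊆c P c′P≡false cP≡true
  rewrite lit≡sum³ c′ | lit≡sum³ c =
  sum³-mono-< (bulb-mono c′⊆c) (proj₁ P) bulb-P
  where
  bulb-P : bulb c′ (proj₁ P) < bulb c (proj₁ P)
  bulb-P rewrite bulb≡indicator c′ P | bulb≡indicator c P | c′P≡false | cP≡true = s≤s z≤n

lit-pos : (c : Config p) → 0 < lit c → ∃ λ P → c P ≡ true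
lit-pos c pos rewrite lit≡sum³ c =
  let (t , bulb>0) = sum³-pos pos ; (n , lit) = bulb-pos c t bulb>0 in (t , n) , lit

infixl 5 _∖_

_∖_ : Config p → Point p → Config p
(c ∖ P) R = c R ∧ not ⌊ R ≟ₚ P ⌋

∖-⊆ : (c : Config p) (P : Point p) → (c ∖ P) ⊆ c
∖-⊆ c P R c∖P-R with c R
... | true = refl

∖-self : (c : Config p) (P : Point p) → (c ∖ P) P ≡ false
∖-self c P with P ≟ₚ P
... | yes _ = ∧-zeroʳ (c P)
... | no P≢P = contradiction refl P≢P

∖-other : (c : Config p) {P R : Point p} → R ≢ P → (c ∖ P) R ≡ c R
∖-other c {P} {R} R≢P with R ≟ₚ P
... | yes R≡P = contradiction R≡P R≢P
... | no _    = ∧-identityʳ (c R)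

lit-∖-< : (c : Config p) (P : Point p) → c P ≡ true → lit (c ∖ P) < lit c
lit-∖-< c P = lit-mono-< (∖-⊆ c P) P (∖-self c P)

TwoLit : Config p → Set
TwoLit {p} c = Σ (Point p) λ P → Σ (Point p) λ Q → c P ≡ true × c Q ≡ true × P ≢ Q

two-lit-points : (c : Config p) → 2 ≤ lit c → TwoLit c
two-lit-points c 2≤lit = P , Q , cP , ∖-⊆ c P Q c∖P-Q , Q≢P ∘ sym
  where
  P = proj₁ (lit-pos c (≤-trans (s≤s z≤n) 2≤lit))
  cP = proj₂ (lit-pos c (≤-trans (s≤s z≤n) 2≤lit))
  lit-c∖P : 0 < lit (c ∖ P)
  lit-c∖P = s≤s⁻¹ (≤-trans 2≤lit (lit-≤-suc (proj₁ P) λ R R≢P cR →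
                                     trans (∖-other c (R≢P ∘ cong proj₁)) cR))
  Q = proj₁ (lit-pos (c ∖ P) lit-c∖P)
  c∖P-Q = proj₂ (lit-pos (c ∖ P) lit-c∖P)
  Q≢P : Q ≢ P
  Q≢P Q≡P = contradiction (trans (sym (∖-self c P)) (subst (λ R → (c ∖ P) R ≡ true) Q≡P c∖P-Q)) λ ()

lit-drops : {c′ c : Config p} {P Q : Point p} (X : Triple p) → P ≢ Q →
            c P ≡ true → c Q ≡ true → c′ P ≡ false → c′ Q ≡ false → c′ ⊆ c outside X →
            lit c′ < lit c
lit-drops {c′ = c′} {c} {P} {Q} X P≢Q cP cQ c′P c′Q c′⊆c = begin-strict
  lit c′                ≤⟨ lit-≤-suc X c′⊆c∖P∖Q ⟩
  suc (lit (c ∖ P ∖ Q)) ≤⟨ lit-∖-< (c ∖ P) Q (trans (∖-other c (P≢Q ∘ sym)) cQ) ⟩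
  lit (c ∖ P)           <⟨ lit-∖-< c P cP ⟩
  lit c                 ∎
  where
  open ≤-Reasoning
  c′⊆c∖P∖Q : c′ ⊆ (c ∖ P ∖ Q) outside X
  c′⊆c∖P∖Q R R≢X c′R = trans (∖-other (c ∖ P) R≢Q) (trans (∖-other c R≢P) (c′⊆c R R≢X c′R))
    where
    R≢P : R ≢ P
    R≢P refl = contradiction (trans (sym c′P) c′R) λ ()
    R≢Q : R ≢ Q
    R≢Q refl = contradiction (trans (sym c′Q) c′R) λ ()

-- Toggling

toggles : List (Line p) → Point p → Bool
toggles ls R = foldr (λ L b → Incident? L R xor b) false ls

flips-toggles : (ls : List (Line p)) (c : Config p) (R : Point p) → flips ls c R ≡ c R xor toggles ls R
flips-toggles []       c R = sym (xor-identityʳ (c R))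
flips-toggles (L ∷ ls) c R with Incident? L R
... | false = flips-toggles ls c R
... | true  = begin
  not (flips ls c R)               ≡⟨ cong not (flips-toggles ls c R) ⟩
  not (c R xor toggles ls R)       ≡⟨ not-distribʳ-xor (c R) (toggles ls R) ⟩
  c R xor not (toggles ls R)       ∎
  where open ≡-Reasoning

toggles-++ : (ls ms : List (Line p)) (R : Point p) → toggles (ls ++ ms) R ≡ toggles ls R xor toggles ms R
toggles-++ []       ms R = refl
toggles-++ (L ∷ ls) ms R =
  trans (cong (Incident? L R xor_) (toggles-++ ls ms R)) (sym (xor-assoc (Incident? L R) _ _))

module _ {R : Point p} where

  toggles-none : (f : Fin n → Line p) → (∀ t → Incident? (f t) R ≡ false) → toggles (tabulate f) R ≡ false
  toggles-none {zero}  f none = refl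
  toggles-none {suc n} f none rewrite none fzero = toggles-none (f ∘ fsuc) (none ∘ fsuc)

  toggles-all : (f : Fin n → Line p) → parity n ≡ 1ℙ → (∀ t → Incident? (f t) R ≡ true) →
                toggles (tabulate f) R ≡ true
  toggles-all {0}           f ()  all
  toggles-all {1}           f odd all rewrite all fzero = refl
  toggles-all {suc (suc n)} f odd all rewrite all fzero | all (fsuc fzero) =
    trans (not-involutive _) (toggles-all (f ∘ fsuc ∘ fsuc) odd (all ∘ fsuc ∘ fsuc))

  toggles-unique : (f : Fin n → Line p) (t₀ : Fin n) → Incident? (f t₀) R ≡ true →
                   (∀ t → Incident? (f t) R ≡ true → t ≡ t₀) → toggles (tabulate f) R ≡ true
  toggles-unique f fzero     hit unique rewrite hit = cong not (toggles-none (f ∘ fsuc) miss)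
    where
    miss : ∀ t → Incident? (f (fsuc t)) R ≡ false
    miss t with Incident? (f (fsuc t)) R in eq
    ... | false = refl
    ... | true  = contradiction (unique (fsuc t) eq) λ ()
  toggles-unique f (fsuc t₀) hit unique with Incident? (f fzero) R in eq
  ... | true  = contradiction (unique fzero eq) λ ()
  ... | false = toggles-unique (f ∘ fsuc) t₀ hit (λ t e → Fin.suc-injective (unique (fsuc t) e))

flipping-pair-reduces : {c : Config p} {P Q : Point p} (ls : List (Line p)) → P ≢ Q →
                        c P ≡ true → c Q ≡ true → toggles ls P ≡ true → toggles ls Q ≡ true →
                        (∀ R → R ≢ P → R ≢ Q → toggles ls R ≡ false) → lit (flips ls c) < lit c
flipping-pair-reduces {c = c} {P} {Q} ls P≢Q cP cQ tP tQ t-other =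
  lit-drops (proj₁ P) P≢Q cP cQ (off P cP tP) (off Q cQ tQ) (λ R _ → flips⊆c R)
  where
  off : ∀ S → c S ≡ true → toggles ls S ≡ true → flips ls c S ≡ false
  off S cS tS rewrite flips-toggles ls c S | cS | tS = refl
  flips⊆c : flips ls c ⊆ c
  flips⊆c R flipped with R ≟ₚ P | R ≟ₚ Q
  ... | yes refl | _        = cP
  ... | no _     | yes refl = cQ
  ... | no R≢P   | no R≢Q   = begin
    c R                    ≡⟨ xor-identityʳ (c R) ⟨
    c R xor false          ≡⟨ cong (c R xor_) (t-other R R≢P R≢Q) ⟨
    c R xor toggles ls R   ≡⟨ flips-toggles ls c R ⟨
    flips ls c R           ≡⟨ flipped ⟩
    true                   ∎
    where open ≡-Reasoning

-- Incidence and arithmetic modulo a prime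

module _ {m : ℕ} (L : Line (suc m)) (R : Point (suc m)) where

  incident⇒dot≡0 : Incident? L R ≡ true → dot (proj₁ L) (proj₁ R) % suc m ≡ 0
  incident⇒dot≡0 incident with dot (proj₁ L) (proj₁ R) % suc m ≟ 0
  ... | yes ≡0 = ≡0

  dot≡0⇒incident : dot (proj₁ L) (proj₁ R) % suc m ≡ 0 → Incident? L R ≡ true
  dot≡0⇒incident ≡0 with dot (proj₁ L) (proj₁ R) % suc m ≟ 0
  ... | yes _  = refl
  ... | no ≢0 = contradiction ≡0 ≢0

  dot≢0⇒¬incident : dot (proj₁ L) (proj₁ R) % suc m ≢ 0 → Incident? L R ≡ false
  dot≢0⇒¬incident ≢0 with dot (proj₁ L) (proj₁ R) % suc m ≟ 0
  ... | yes ≡0 = contradiction ≡0 ≢0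
  ... | no _   = refl

[m+n]%d≡m%d⇒d∣n : ∀ m n d .{{_ : NonZero d}} → (m + n) % d ≡ m % d → d ∣ n
[m+n]%d≡m%d⇒d∣n m n d eq = ∣m+n∣m⇒∣n (subst (d ∣_) split (n∣m*n ((m + n) / d))) (n∣m*n (m / d))
  where
  open ≡-Reasoning
  split : (m + n) / d * d ≡ m / d * d + n
  split = +-cancelˡ-≡ (m % d) _ _ (begin
    m % d + (m + n) / d * d      ≡⟨ cong (_+ (m + n) / d * d) eq ⟨
    (m + n) % d + (m + n) / d * d ≡⟨ m≡m%n+[m/n]*n (m + n) d ⟨
    m + n                         ≡⟨ cong (_+ n) (m≡m%n+[m/n]*n m d) ⟩
    m % d + m / d * d + n         ≡⟨ +-assoc (m % d) _ n ⟩
    m % d + (m / d * d + n)       ∎)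

[m+n%d*o]%d≡[m+n*o]%d : ∀ m n o d .{{_ : NonZero d}} → (m + n % d * o) % d ≡ (m + n * o) % d
[m+n%d*o]%d≡[m+n*o]%d m n o d = sym (begin
  (m + n * o) % d                              ≡⟨ cong (λ n′ → (m + n′ * o) % d) (m≡m%n+[m/n]*n n d) ⟩
  (m + (n % d + n / d * d) * o) % d            ≡⟨ cong (_% d) (regroup m (n % d) (n / d) o d) ⟩
  (m + n % d * o + n / d * o * d) % d          ≡⟨ [m+kn]%n≡m%n (m + n % d * o) (n / d * o) d ⟩
  (m + n % d * o) % d                          ∎)
  where
  open ≡-Reasoning
  open +-*-Solver
  regroup : ∀ m r q o d → m + (r + q * d) * o ≡ m + r * o + q * o * d
  regroup = solve 5 (λ m r q o d → m :+ (r :+ q :* d) :* o := m :+ r :* o :+ q :* o :* d) refl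

injective⇒surjective : (f : Fin n → Fin n) → Injective _≡_ _≡_ f → ∀ j → ∃ λ i → f i ≡ j
injective⇒surjective {suc n} f f-inj j with Fin.any? (λ i → f i Fin.≟ j)
... | yes hit = hit
... | no miss = contradiction (λ {i i′} → g-inj {i} {i′}) (Fin.<⇒notInjective ℕ.≤-refl)
  where
  g : Fin (suc n) → Fin n
  g i = punchOut {i = j} (λ j≡fi → miss (i , sym j≡fi))
  g-inj : Injective _≡_ _≡_ g
  g-inj {i} {i′} =
    f-inj ∘ Fin.punchOut-injective {i = j} (λ j≡fi → miss (i , sym j≡fi)) (λ j≡fi′ → miss (i′ , sym j≡fi′))

module _ {m : ℕ} (p-prime : Prime (suc m)) {a : ℕ} (a≢0 : a % suc m ≢ 0) (k : ℕ) where

  private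
    p∣[v∸u]*a : ∀ {u v} → u < v → (k + u * a) % suc m ≡ (k + v * a) % suc m → suc m ∣ (v ∸ u) * a
    p∣[v∸u]*a {u} {v} u<v eq =
      [m+n]%d≡m%d⇒d∣n (k + u * a) ((v ∸ u) * a) (suc m) (trans (cong (_% suc m) (sym shift)) (sym eq))
      where
      open ≡-Reasoning
      shift : k + v * a ≡ k + u * a + (v ∸ u) * a
      shift = begin
        k + v * a                   ≡⟨ cong (λ w → k + w * a) (ℕ.m+[n∸m]≡n (ℕ.<⇒≤ u<v)) ⟨
        k + (u + (v ∸ u)) * a       ≡⟨ cong (k +_) (ℕ.*-distribʳ-+ a u (v ∸ u)) ⟩
        k + (u * a + (v ∸ u) * a)   ≡⟨ +-assoc k _ _ ⟨
        k + u * a + (v ∸ u) * a     ∎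

    no-collision : ∀ {u v} → u < v → v < suc m → (k + u * a) % suc m ≢ (k + v * a) % suc m
    no-collision {u} {v} u<v v<p eq with euclidsLemma (v ∸ u) a p-prime (p∣[v∸u]*a u<v eq)
    ... | inj₂ p∣a   = a≢0 (n∣m⇒m%n≡0 a (suc m) p∣a)
    ... | inj₁ p∣v∸u = small (ℕ.m<n⇒0<n∸m u<v) (ℕ.≤-<-trans (ℕ.m∸n≤m v u) v<p) p∣v∸u
      where
      small : ∀ {e} → 0 < e → e < suc m → ¬ (suc m ∣ e)
      small {suc e} _ e<p p∣e = ℕ.<⇒≱ e<p (∣⇒≤ p∣e)

  affine-injective : {t t′ : Fin (suc m)} → (k + toℕ t * a) % suc m ≡ (k + toℕ t′ * a) % suc m → t ≡ t′
  affine-injective {t} {t′} eq with ℕ.<-cmp (toℕ t) (toℕ t′)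
  ... | tri< t<t′ _ _ = contradiction eq (no-collision t<t′ (Fin.toℕ<n t′))
  ... | tri≈ _ t≡t′ _ = Fin.toℕ-injective t≡t′
  ... | tri> _ _ t>t′ = contradiction (sym eq) (no-collision t>t′ (Fin.toℕ<n t))

  affine-root : ∃ λ (t : Fin (suc m)) → (k + toℕ t * a) % suc m ≡ 0
  affine-root =
    let (t , ft≡0) = injective⇒surjective f f-inj fzero in t , trans (sym (toℕ-f t)) (cong toℕ ft≡0)
    where
    f : Fin (suc m) → Fin (suc m)
    f t = fromℕ< (m%n<n (k + toℕ t * a) (suc m))
    toℕ-f : ∀ t → toℕ (f t) ≡ (k + toℕ t * a) % suc m
    toℕ-f t = Fin.toℕ-fromℕ< _
    f-inj : Injective _≡_ _≡_ f
    f-inj {t} {t′} ft≡ft′ =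
      affine-injective (trans (sym (toℕ-f t)) (trans (cong toℕ ft≡ft′) (toℕ-f t′)))

-- Planes of odd order

module OddPlane {q : ℕ} (p-prime : Prime (2 + q)) (odd : parity (2 + q) ≡ 1ℙ) where

  private
    𝑝 : ℕ
    𝑝 = 2 + q

  X Y Z : Triple 𝑝 → ℕ
  X (x , _ , _) = toℕ x
  Y (_ , y , _) = toℕ y
  Z (_ , _ , z) = toℕ z

  one : Fin 𝑝
  one = fsuc fzero

  data Chart : Triple 𝑝 → Set where
    chart₀ : ∀ y z → Chart (one , y , z)
    chart₁ : ∀ z → Chart (fzero , one , z)
    chart₂ : Chart (fzero , fzero , one)

  chart : {t : Triple 𝑝} → Normalized t → Chart t
  chart {x , y , z} (inj₁ x≡1)
    with refl ← Fin.toℕ-injective {i = x} {j = one} x≡1 = chart₀ y z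
  chart {x , y , z} (inj₂ (inj₁ (x≡0 , y≡1)))
    with refl ← Fin.toℕ-injective {i = x} {j = fzero} x≡0
       | refl ← Fin.toℕ-injective {i = y} {j = one} y≡1 = chart₁ z
  chart {x , y , z} (inj₂ (inj₂ (x≡0 , y≡0 , z≡1)))
    with refl ← Fin.toℕ-injective {i = x} {j = fzero} x≡0
       | refl ← Fin.toℕ-injective {i = y} {j = fzero} y≡0
       | refl ← Fin.toℕ-injective {i = z} {j = one} z≡1 = chart₂

  1%𝑝≢0 : 1 % 𝑝 ≢ 0
  1%𝑝≢0 ()

  %𝑝≡0⇒≡0 : (u : Fin 𝑝) → toℕ u % 𝑝 ≡ 0 → u ≡ fzero
  %𝑝≡0⇒≡0 u u≡0 = Fin.toℕ-injective (trans (sym (m<n⇒m%n≡m (Fin.toℕ<n u))) u≡0)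

  ≢0⇒%𝑝≢0 : (u : Fin 𝑝) → toℕ u ≢ 0 → toℕ u % 𝑝 ≢ 0
  ≢0⇒%𝑝≢0 u u≢0 = u≢0 ∘ trans (sym (m<n⇒m%n≡m (Fin.toℕ<n u)))

  -- `axis` is the zero set of α and `line t` that of κ + t·α; as α and κ vanish
  -- together only at C, these are the 𝑝 + 1 lines through C.
  record Pencil (C : Point 𝑝) : Set where
    field
      line : Fin 𝑝 → Line 𝑝
      axis : Line 𝑝
      κ α  : Triple 𝑝 → ℕ
      line-dot : ∀ t r → dot (proj₁ (line t)) r % 𝑝 ≡ (κ r + toℕ t * α r) % 𝑝
      axis-dot : ∀ r → dot (proj₁ axis) r % 𝑝 ≡ α r % 𝑝
      centre-α : α (proj₁ C) % 𝑝 ≡ 0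
      centre-κ : κ (proj₁ C) % 𝑝 ≡ 0
      centre-unique : ∀ R → α (proj₁ R) % 𝑝 ≡ 0 → κ (proj₁ R) % 𝑝 ≡ 0 → R ≡ C

    lines : List (Line 𝑝)
    lines = axis ∷ tabulate line

    private
      line-dot-α≡0 : ∀ t r → α r % 𝑝 ≡ 0 → dot (proj₁ (line t)) r % 𝑝 ≡ κ r % 𝑝
      line-dot-α≡0 t r α≡0 =
        trans (line-dot t r) (%-remove-+ʳ (κ r) (∣n⇒∣m*n (toℕ t) (m%n≡0⇒n∣m (α r) 𝑝 α≡0)))

    -- The centre lies on all 𝑝 + 1 lines, an even number.
    toggles-centre : toggles lines C ≡ false
    toggles-centre = cong₂ _xor_
      (dot≡0⇒incident axis C (trans (axis-dot (proj₁ C)) centre-α))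
      (toggles-all line odd λ t →
        dot≡0⇒incident (line t) C (trans (line-dot-α≡0 t (proj₁ C) centre-α) centre-κ))

    -- Any other point lies on exactly one of them.
    toggles-other : ∀ {R} → R ≢ C → toggles lines R ≡ true
    toggles-other {R} R≢C with α (proj₁ R) % 𝑝 ≟ 0
    ... | yes α≡0 = cong₂ _xor_
      (dot≡0⇒incident axis R (trans (axis-dot (proj₁ R)) α≡0))
      (toggles-none line λ t →
        dot≢0⇒¬incident (line t) R (κ≢0 ∘ trans (sym (line-dot-α≡0 t (proj₁ R) α≡0))))
      where
      κ≢0 : κ (proj₁ R) % 𝑝 ≢ 0
      κ≢0 κ≡0 = R≢C (centre-unique R α≡0 κ≡0)
    ... | no α≢0 = cong₂ _xor_
      (dot≢0⇒¬incident axis R (α≢0 ∘ trans (sym (axis-dot (proj₁ R)))))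
      (toggles-unique line t₀ (dot≡0⇒incident (line t₀) R (trans (line-dot t₀ (proj₁ R)) root)) λ t hit →
        affine-injective p-prime α≢0 (κ (proj₁ R))
          (trans (sym (line-dot t (proj₁ R))) (trans (incident⇒dot≡0 (line t) R hit) (sym root))))
      where
      t₀ = proj₁ (affine-root p-prime α≢0 (κ (proj₁ R)))
      root = proj₂ (affine-root p-prime α≢0 (κ (proj₁ R)))

  open Pencil using (lines; toggles-centre; toggles-other)

  line₀ : Fin 𝑝 → Fin 𝑝 → Line 𝑝
  line₀ b c = (one , b , c) , inj₁ refl

  line₁ : Fin 𝑝 → Line 𝑝
  line₁ c = (fzero , one , c) , inj₂ (inj₁ (refl , refl))

  line₂ : Line 𝑝
  line₂ = (fzero , fzero , one) , inj₂ (inj₂ (refl , refl , refl))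

  dot-line₀ : ∀ b c r → dot (proj₁ (line₀ b c)) r ≡ X r + toℕ b * Y r + toℕ c * Z r
  dot-line₀ b c r = cong (λ x → x + toℕ b * Y r + toℕ c * Z r) (ℕ.+-identityʳ (X r))

  dot-line₁ : ∀ c r → dot (proj₁ (line₁ c)) r ≡ Y r + toℕ c * Z r
  dot-line₁ c r = cong (_+ toℕ c * Z r) (ℕ.+-identityʳ (Y r))

  dot-line₂ : ∀ r → dot (proj₁ line₂) r ≡ Z r
  dot-line₂ r = ℕ.+-identityʳ (Z r)

  e₀ : Point 𝑝
  e₀ = (one , fzero , fzero) , inj₁ refl

  e₀-unique : {r : Triple 𝑝} → Chart r → Z r % 𝑝 ≡ 0 → Y r % 𝑝 ≡ 0 → r ≡ proj₁ e₀
  e₀-unique (chart₀ y z) z≡0 y≡0 with refl ← %𝑝≡0⇒≡0 z z≡0 | refl ← %𝑝≡0⇒≡0 y y≡0 = refl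
  e₀-unique (chart₁ z)   _   y≡0 = contradiction y≡0 1%𝑝≢0
  e₀-unique chart₂       z≡0 _   = contradiction z≡0 1%𝑝≢0

  pencil-e₀ : Pencil e₀
  pencil-e₀ = record
    { line = line₁
    ; axis = line₂
    ; κ = Y
    ; α = Z
    ; line-dot = λ t r → cong (_% 𝑝) (dot-line₁ t r)
    ; axis-dot = λ r → cong (_% 𝑝) (dot-line₂ r)
    ; centre-α = refl
    ; centre-κ = refl
    ; centre-unique = λ R z≡0 y≡0 → point-≡ (e₀-unique (chart (proj₂ R)) z≡0 y≡0)
    }

  product≡0 : (u : Fin 𝑝) {v : ℕ} → v % 𝑝 ≢ 0 → (toℕ u * v) % 𝑝 ≡ 0 → u ≡ fzero
  product≡0 u v≢0 uv≡0 = affine-injective p-prime v≢0 0 uv≡0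

  coefficient≢0 : (u : Fin 𝑝) (m : ℕ) → (1 + toℕ u * m) % 𝑝 ≡ 0 → toℕ u % 𝑝 ≢ 0
  coefficient≢0 u m eq u≡0 with refl ← %𝑝≡0⇒≡0 u u≡0 = 1%𝑝≢0 eq

  root-uniqueʳ : (k a : ℕ) → a % 𝑝 ≢ 0 → (u v : Fin 𝑝) →
                 (k + a * toℕ u) % 𝑝 ≡ 0 → (k + a * toℕ v) % 𝑝 ≡ 0 → u ≡ v
  root-uniqueʳ k a a≢0 u v u-root v-root =
    affine-injective p-prime a≢0 k (trans (swap u) (trans u-root (sym (trans (swap v) v-root))))
    where
    swap : ∀ w → (k + toℕ w * a) % 𝑝 ≡ (k + a * toℕ w) % 𝑝
    swap w = cong (λ aw → (k + aw) % 𝑝) (ℕ.*-comm (toℕ w) a)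

  shift-unique : (m : ℕ) (u v : Fin 𝑝) → (toℕ u + m) % 𝑝 ≡ 0 → (toℕ v + m) % 𝑝 ≡ 0 → u ≡ v
  shift-unique m u v u-root v-root =
    affine-injective p-prime 1%𝑝≢0 m (trans (swap u) (trans u-root (sym (trans (swap v) v-root))))
    where
    swap : ∀ w → (m + toℕ w * 1) % 𝑝 ≡ (toℕ w + m) % 𝑝
    swap w = cong (_% 𝑝) (trans (cong (m +_) (ℕ.*-identityʳ (toℕ w))) (ℕ.+-comm m (toℕ w)))

  ∞-unique : (b : Fin 𝑝) {r s : Triple 𝑝} → Chart r → Chart s →
             Z r % 𝑝 ≡ 0 → (X r + toℕ b * Y r) % 𝑝 ≡ 0 →
             Z s % 𝑝 ≡ 0 → (X s + toℕ b * Y s) % 𝑝 ≡ 0 → r ≡ s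
  ∞-unique b (chart₀ y z) (chart₀ y′ z′) zr κr zs κs
    with refl ← %𝑝≡0⇒≡0 z zr | refl ← %𝑝≡0⇒≡0 z′ zs
       | refl ← root-uniqueʳ 1 (toℕ b) (coefficient≢0 b (toℕ y′) κs) y y′ κr κs = refl
  ∞-unique b (chart₀ y z) (chart₁ z′) _ κr _ κs
    with refl ← product≡0 b 1%𝑝≢0 κs = contradiction κr 1%𝑝≢0
  ∞-unique b (chart₁ z) (chart₀ y′ z′) _ κr _ κs
    with refl ← product≡0 b 1%𝑝≢0 κr = contradiction κs 1%𝑝≢0
  ∞-unique b (chart₁ z) (chart₁ z′) zr _ zs _
    with refl ← %𝑝≡0⇒≡0 z zr | refl ← %𝑝≡0⇒≡0 z′ zs = refl
  ∞-unique b chart₂ _ zr _ _ _ = contradiction zr 1%𝑝≢0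
  ∞-unique b _ chart₂ _ _ zs _ = contradiction zs 1%𝑝≢0

  affine-unique : (g c : Fin 𝑝) {r s : Triple 𝑝} → Chart r → Chart s → Z s % 𝑝 ≢ 0 →
                  (Y r + toℕ g * Z r) % 𝑝 ≡ 0 → (X r + toℕ c * Z r) % 𝑝 ≡ 0 →
                  (Y s + toℕ g * Z s) % 𝑝 ≡ 0 → (X s + toℕ c * Z s) % 𝑝 ≡ 0 → r ≡ s
  affine-unique g c (chart₀ y z) (chart₀ y′ z′) _ αr κr αs κs
    with refl ← root-uniqueʳ 1 (toℕ c) (coefficient≢0 c (toℕ z′) κs) z z′ κr κs
    with refl ← shift-unique (toℕ g * toℕ z) y y′ αr αs = refl
  affine-unique g c (chart₀ y z) (chart₁ z′) z′≢0 _ κr _ κs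
    with refl ← product≡0 c z′≢0 κs = contradiction κr 1%𝑝≢0
  affine-unique g c (chart₀ y z) chart₂ _ _ κr _ κs
    with refl ← product≡0 c 1%𝑝≢0 κs = contradiction κr 1%𝑝≢0
  affine-unique g c (chart₁ z) (chart₀ y′ z′) _ αr κr _ κs
    with refl ← product≡0 z (coefficient≢0 c (toℕ z′) κs)
                  (trans (cong (_% 𝑝) (ℕ.*-comm (toℕ z) (toℕ c))) κr)
    = contradiction (trans (cong (λ gz → (1 + gz) % 𝑝) (sym (ℕ.*-zeroʳ (toℕ g)))) αr) 1%𝑝≢0
  affine-unique g c (chart₁ z) (chart₁ z′) _ αr _ αs _
    with refl ← root-uniqueʳ 1 (toℕ g) (coefficient≢0 g (toℕ z′) αs) z z′ αr αs = refl
  affine-unique g c (chart₁ z) chart₂ _ αr _ αs _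
    with refl ← product≡0 g 1%𝑝≢0 αs = contradiction αr 1%𝑝≢0
  affine-unique g c chart₂ (chart₀ y′ z′) _ _ κr _ κs
    with refl ← product≡0 c 1%𝑝≢0 κr = contradiction κs 1%𝑝≢0
  affine-unique g c chart₂ (chart₁ z′) _ αr _ αs _
    with refl ← product≡0 g 1%𝑝≢0 αr = contradiction αs 1%𝑝≢0
  affine-unique g c chart₂ chart₂ _ _ _ _ _ = refl

  Y%𝑝≢0 : {r : Triple 𝑝} → Chart r → Z r ≡ 0 → r ≢ proj₁ e₀ → Y r % 𝑝 ≢ 0
  Y%𝑝≢0 (chart₀ y z) z≡0 r≢e₀ y≡0
    with refl ← Fin.toℕ-injective {i = z} {j = fzero} z≡0 | refl ← %𝑝≡0⇒≡0 y y≡0 = r≢e₀ refl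
  Y%𝑝≢0 (chart₁ z) _ _ = 1%𝑝≢0

  pencil-∞ : (C : Point 𝑝) → C ≢ e₀ → Z (proj₁ C) ≡ 0 → Pencil C
  pencil-∞ C C≢e₀ z≡0 = record
    { line = line₀ b
    ; axis = line₂
    ; κ = λ r → X r + toℕ b * Y r
    ; α = Z
    ; line-dot = λ t r → cong (_% 𝑝) (dot-line₀ b t r)
    ; axis-dot = λ r → cong (_% 𝑝) (dot-line₂ r)
    ; centre-α = cong (_% 𝑝) z≡0
    ; centre-κ = b-root
    ; centre-unique = λ R zR κR →
        point-≡ (∞-unique b (chart (proj₂ R)) (chart (proj₂ C)) zR κR (cong (_% 𝑝) z≡0) b-root)
    }
    where
    y≢0 = Y%𝑝≢0 (chart (proj₂ C)) z≡0 (C≢e₀ ∘ point-≡)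
    b = proj₁ (affine-root p-prime y≢0 (X (proj₁ C)))
    b-root = proj₂ (affine-root p-prime y≢0 (X (proj₁ C)))

  pencil-affine : (C : Point 𝑝) → Z (proj₁ C) ≢ 0 → Pencil C
  pencil-affine C z≢0 = record
    { line = λ t → line₀ t (c+tg t)
    ; axis = line₁ g
    ; κ = λ r → X r + toℕ c * Z r
    ; α = λ r → Y r + toℕ g * Z r
    ; line-dot = line-dot
    ; axis-dot = λ r → cong (_% 𝑝) (dot-line₁ g r)
    ; centre-α = g-root
    ; centre-κ = c-root
    ; centre-unique = λ R αR κR →
        point-≡ (affine-unique g c (chart (proj₂ R)) (chart (proj₂ C)) z%𝑝≢0 αR κR g-root c-root)
    }
    where
    z%𝑝≢0 = ≢0⇒%𝑝≢0 (proj₂ (proj₂ (proj₁ C))) z≢0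
    g = proj₁ (affine-root p-prime z%𝑝≢0 (Y (proj₁ C)))
    g-root = proj₂ (affine-root p-prime z%𝑝≢0 (Y (proj₁ C)))
    c = proj₁ (affine-root p-prime z%𝑝≢0 (X (proj₁ C)))
    c-root = proj₂ (affine-root p-prime z%𝑝≢0 (X (proj₁ C)))
    c+tg : Fin 𝑝 → Fin 𝑝
    c+tg t = fromℕ< (m%n<n (toℕ c + toℕ t * toℕ g) 𝑝)
    toℕ-c+tg : ∀ t → toℕ (c+tg t) ≡ (toℕ c + toℕ t * toℕ g) % 𝑝
    toℕ-c+tg t = Fin.toℕ-fromℕ< (m%n<n (toℕ c + toℕ t * toℕ g) 𝑝)
    line-dot : ∀ t r → dot (proj₁ (line₀ t (c+tg t))) r % 𝑝 ≡
                       (X r + toℕ c * Z r + toℕ t * (Y r + toℕ g * Z r)) % 𝑝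
    line-dot t r = begin
      dot (proj₁ (line₀ t (c+tg t))) r % 𝑝
        ≡⟨ cong (_% 𝑝) (dot-line₀ t (c+tg t) r) ⟩
      (X r + toℕ t * Y r + toℕ (c+tg t) * Z r) % 𝑝
        ≡⟨ cong (λ e → (X r + toℕ t * Y r + e * Z r) % 𝑝) (toℕ-c+tg t) ⟩
      (X r + toℕ t * Y r + (toℕ c + toℕ t * toℕ g) % 𝑝 * Z r) % 𝑝
        ≡⟨ [m+n%d*o]%d≡[m+n*o]%d (X r + toℕ t * Y r) (toℕ c + toℕ t * toℕ g) (Z r) 𝑝 ⟩
      (X r + toℕ t * Y r + (toℕ c + toℕ t * toℕ g) * Z r) % 𝑝
        ≡⟨ cong (_% 𝑝) (regroup (X r) (Y r) (Z r) (toℕ c) (toℕ t) (toℕ g)) ⟩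
      (X r + toℕ c * Z r + toℕ t * (Y r + toℕ g * Z r)) % 𝑝
        ∎
      where
      open ≡-Reasoning
      open +-*-Solver
      regroup : ∀ x y z c t g → x + t * y + (c + t * g) * z ≡ x + c * z + t * (y + g * z)
      regroup = solve 6 (λ x y z c t g →
        x :+ t :* y :+ (c :+ t :* g) :* z := x :+ c :* z :+ t :* (y :+ g :* z)) refl

  pencil : (C : Point 𝑝) → Pencil C
  pencil C with C ≟ₚ e₀ | Z (proj₁ C) ≟ 0
  ... | yes refl | _       = pencil-e₀
  ... | no C≢e₀ | yes z≡0 = pencil-∞ C C≢e₀ z≡0
  ... | no _    | no z≢0  = pencil-affine C z≢0

  pair-lines : Point 𝑝 → Point 𝑝 → List (Line 𝑝)
  pair-lines P Q = lines (pencil P) ++ lines (pencil Q)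

  toggles-pair : {P Q : Point 𝑝} → P ≢ Q →
                 toggles (pair-lines P Q) P ≡ true × toggles (pair-lines P Q) Q ≡ true ×
                 (∀ R → R ≢ P → R ≢ Q → toggles (pair-lines P Q) R ≡ false)
  toggles-pair {P} {Q} P≢Q =
    split P (toggles-centre (pencil P)) (toggles-other (pencil Q) P≢Q) ,
    split Q (toggles-other (pencil P) (P≢Q ∘ sym)) (toggles-centre (pencil Q)) ,
    λ R R≢P R≢Q → split R (toggles-other (pencil P) R≢P) (toggles-other (pencil Q) R≢Q)
    where
    split : ∀ R {a b} → toggles (lines (pencil P)) R ≡ a → toggles (lines (pencil Q)) R ≡ b →
            toggles (pair-lines P Q) R ≡ a xor b
    split R eqP eqQ = trans (toggles-++ (lines (pencil P)) (lines (pencil Q)) R) (cong₂ _xor_ eqP eqQ)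

  two-lit⇒reducible : (c : Config 𝑝) → TwoLit c → Reducible c
  two-lit⇒reducible c (P , Q , cP , cQ , P≢Q) =
    pair-lines P Q , flipping-pair-reduces {c = c} (pair-lines P Q) P≢Q cP cQ tP tQ t-other
    where
    tP = proj₁ (toggles-pair P≢Q)
    tQ = proj₁ (proj₂ (toggles-pair P≢Q))
    t-other = proj₂ (proj₂ (toggles-pair P≢Q))

-- The Fano plane

all³? : {P : Triple p → Set} → (∀ t → Dec (P t)) → Dec (∀ t → P t)
all³? P? = map′ (λ all (x , y , z) → all x y z) (λ all x y z → all (x , y , z))
                (Fin.all? λ x → Fin.all? λ y → Fin.all? λ z → P? (x , y , z))

any³? : {P : Triple p → Set} → (∀ t → Dec (P t)) → Dec (∃ P)
any³? P? = map′ (λ (x , y , z , hit) → (x , y , z) , hit) (λ ((x , y , z) , hit) → x , y , z , hit)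
                (Fin.any? λ x → Fin.any? λ y → Fin.any? λ z → P? (x , y , z))

private
  On : Triple 2 → Triple 2 → Set
  On l r = dot l r % 2 ≡ 0

ThreePointLine : Triple 2 → Triple 2 → Set
ThreePointLine s t = Σ (Triple 2) λ l → Normalized l × On l s × On l t ×
                       Σ (Triple 2) λ x → ∀ r → Normalized r → On l r → r ≡ s ⊎ r ≡ t ⊎ r ≡ x

-- Found by exhaustive search over the 8 coordinate triples; opaque, so that
-- using the witness does not unfold the search again.
opaque
  three-point-line : ∀ s t → Normalized s → Normalized t → s ≢ t → ThreePointLine s t
  three-point-line = toWitness {a? = all³? λ s → all³? λ t →
    normalized? s →-dec normalized? t →-dec ¬? (s ≟ₜ t) →-dec three-point-line? s t} tt
    where
    three-point-line? : ∀ s t → Dec (ThreePointLine s t)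
    three-point-line? s t = any³? λ l →
      normalized? l ×-dec dot l s % 2 ≟ 0 ×-dec dot l t % 2 ≟ 0 ×-dec any³? λ x → all³? λ r →
        normalized? r →-dec dot l r % 2 ≟ 0 →-dec (r ≟ₜ s ⊎-dec r ≟ₜ t ⊎-dec r ≟ₜ x)

two-lit⇒reducible₂ : (c : Config 2) → TwoLit c → Reducible c
two-lit⇒reducible₂ c (P , Q , cP , cQ , P≢Q) =
  flip-join (three-point-line (proj₁ P) (proj₁ Q) (proj₂ P) (proj₂ Q) (P≢Q ∘ point-≡))
  where
  flip-join : ThreePointLine (proj₁ P) (proj₁ Q) → Reducible c
  flip-join (l , l-normalized , l∋P , l∋Q , x , only) =
    L ∷ [] , lit-drops x P≢Q cP cQ (off P cP (dot≡0⇒incident L P l∋P))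
                                   (off Q cQ (dot≡0⇒incident L Q l∋Q)) c′⊆c
    where
    L : Line 2
    L = l , l-normalized
    off : ∀ S → c S ≡ true → Incident? L S ≡ true → flips (L ∷ []) c S ≡ false
    off S cS L∋S rewrite L∋S | cS = refl
    c′⊆c : flips (L ∷ []) c ⊆ c outside x
    c′⊆c R R≢x c′R with Incident? L R in L∋R
    ... | false = c′R
    ... | true with only (proj₁ R) (proj₂ R) (incident⇒dot≡0 L R L∋R)
    ...   | inj₁ R≡P        = subst (λ S → c S ≡ true) (sym (point-≡ R≡P)) cP
    ...   | inj₂ (inj₁ R≡Q) = subst (λ S → c S ≡ true) (sym (point-≡ R≡Q)) cQ
    ...   | inj₂ (inj₂ R≡x) = contradiction R≡x R≢x

parity≡0ℙ⇒2∣ : ∀ n → parity n ≡ 0ℙ → 2 ∣ n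
parity≡0ℙ⇒2∣ 0             _    = 2 ∣0
parity≡0ℙ⇒2∣ (suc (suc n)) even = ∣m∣n⇒∣m+n (∣-refl {2}) (parity≡0ℙ⇒2∣ n even)

prime-two-or-odd : Prime (2 + n) → n ≡ 0 ⊎ parity (2 + n) ≡ 1ℙ
prime-two-or-odd {n} p-prime with parity n in eq
... | 1ℙ = inj₂ refl
... | 0ℙ with prime⇒irreducible p-prime (∣m∣n⇒∣m+n (∣-refl {2}) (parity≡0ℙ⇒2∣ n eq))
...   | inj₁ ()
...   | inj₂ 2≡2+n = inj₁ (ℕ.+-cancelˡ-≡ 2 n 0 (sym 2≡2+n))

lemma1 : (p : ℕ) → Prime p → (c : Config p) → 2 ≤ lit c → Reducible c
lemma1 0             p-prime c _     = contradiction (nonTrivial⇒n>1 0 {{prime⇒nonTrivial p-prime}}) λ ()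
lemma1 1             p-prime c _     = contradiction (nonTrivial⇒n>1 1 {{prime⇒nonTrivial p-prime}}) (ℕ.n≮n 1)
lemma1 (suc (suc n)) p-prime c 2≤lit with prime-two-or-odd p-prime
... | inj₁ refl = two-lit⇒reducible₂ c (two-lit-points c 2≤lit)
... | inj₂ odd  = OddPlane.two-lit⇒reducible p-prime odd c (two-lit-points c 2≤lit)
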